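{- Let $\mathcal A$ be an S-ring over a finite cyclic group $G$. Suppose that an $\mathcal A$-group $H$ has an $\mathcal A$-complement and that $\mathcal A_S=\mathbb Z S$ for some $\mathcal A$-section $S$ projectively equivalent to $G/H$. Then for every $\mathcal A$-section $T$ projectively equivalent to $H/1$, the S-ring $\mathcal A$ is Cayley isomorphic to $\mathcal A_S\otimes\mathcal A_T$.
   Context: An S-ring over a finite group $G$ is a subring $\mathcal A$ of $\mathbb Z G$ spanned by the sums $\underline X=\sum_{x\in X}x$ over the blocks $X$ of a partition of $G$ (basic sets) containing $\{e\}$ and closed under $X\mapsto X^{ -1}$. An $\mathcal A$-group is a subgroup that is a union of basic sets; an $\mathcal A$-section is $U/L$ with $L\le U$ $\mathcal A$-groups, with restriction $\mathcal A_{U/L}$ the S-ring over $U/L$ whose basic sets are the images of basic sets contained in $U$. $\mathcal A_S=\mathbb ZS$ means that all basic sets of $\mathcal A_S$ are singletons. An $\mathcal A$-complement of an $\mathcal A$-group $H$ is an $\mathcal A$-group $H'$ with $G=H\times H'$. Projective equivalence of $\mathcal A$-sections is the equivalence relation generated by the relation $U_1/L_1\to U_2/L_2$ holding when $U_1\cap L_2=L_1$ and $U_1L_2=U_2$. For S-rings $\mathcal A_1$ over $G_1$ and $\mathcal A_2$ over $G_2$, $\mathcal A_1\otimes\mathcal A_2$ is the S-ring over $G_1\times G_2$ with basic sets $X_1\times X_2$, $X_i$ basic sets of $\mathcal A_i$. S-rings $\mathcal A$ over $G$ and $\mathcal A'$ over $G'$ are Cayley isomorphic if some group isomorphism $G\to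 G'$ maps the basic sets of $\mathcal A$ onto the basic sets of $\mathcal A'$. -}

module Defs where

open import Data.Nat using (ℕ; suc; _+_; _∸_; _%_)
open import Data.Nat.DivMod using (m%n<n)
open import Data.Fin using (Fin; zero; toℕ; fromℕ<)
open import Data.Fin.Subset using (Subset; _∈_; ⊤; ⁅_⁆)
open import Data.List using (List; length; filter)
open import Data.List.Base using ()
open import Data.Fin.Base using ()
open import Data.Product using (Σ; ∃; ∃-syntax; _×_; _,_)
open import Function.Bundles using (_⇔_)
open import Relation.Binary.PropositionalEquality using (_≡_)
open import Relation.Binary.Core using (Rel)
open import Relation.Binary.Construct.Closure.Equivalence using (EqClosure)
open import Relation.Nullary.Decidable using (_×-dec_)
import Data.Nat as ℕ

Zn : ℕ → Set
Zn n = Fin (suc n)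

module _ {n : ℕ} where

  infixl 6 _+ₙ_ _-ₙ_

  _+ₙ_ : Zn n → Zn n → Zn n
  i +ₙ j = fromℕ< (m%n<n (toℕ i + toℕ j) (suc n))

  -ₙ_ : Zn n → Zn n
  -ₙ i = fromℕ< (m%n<n (suc n ∸ toℕ i) (suc n))

  _-ₙ_ : Zn n → Zn n → Zn n
  i -ₙ j = i +ₙ (-ₙ j)

  allElems : List (Zn n)
  allElems = Data.List.Base.tabulate (λ i → i)

-- S-rings over ℤ/(suc n)ℤ.  The partition of the group into basic sets
-- is given as the fibres of a labelling function `lab`: the basic set
-- containing x is {y | lab y ≡ lab x}.
--
-- `mult lab x y z` is the coefficient of z in X·Y (in ℤG), where X, Y
-- are the basic sets containing x, y:  #{ a ∈ X | z - a ∈ Y }.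
-- The span of the basic sums is closed under multiplication iff each
-- such coefficient is constant on every basic set.

mult : ∀ {n} → (Zn n → ℕ) → Zn n → Zn n → Zn n → ℕ
mult lab x y z =
  length (filter (λ a → (lab a ℕ.≟ lab x) ×-dec (lab (z -ₙ a) ℕ.≟ lab y)) allElems)

record SRing (n : ℕ) : Set where
  field
    lab : Zn n → ℕ
    identityBasic : ∀ x → lab x ≡ lab zero → x ≡ zero
    inverseClosed : ∀ x y → lab x ≡ lab y → lab (-ₙ x) ≡ lab (-ₙ y)
    multClosed : ∀ x y z z′ → lab z ≡ lab z′ → mult lab x y z ≡ mult lab x y z′

module _ {n : ℕ} (A : SRing n) where
  open SRing A

  IsSubgroup : Subset (suc n) → Set
  IsSubgroup H = (zero ∈ H)
               × (∀ x y → x ∈ H → y ∈ H → (x +ₙ y) ∈ H)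
               × (∀ x → x ∈ H → (-ₙ x) ∈ H)

  IsAGroup : Subset (suc n) → Set
  IsAGroup H = IsSubgroup H × (∀ x y → lab x ≡ lab y → x ∈ H → y ∈ H)

  record ASection : Set where
    constructor sec
    field
      U L : Subset (suc n)
      U-AGroup : IsAGroup U
      L-AGroup : IsAGroup L
      L⊆U : ∀ x → x ∈ L → x ∈ U

  open ASection public

  _⟶_ : Rel ASection _
  S₁ ⟶ S₂ =
      (∀ x → (x ∈ L S₁) ⇔ (x ∈ U S₁ × x ∈ L S₂))
    × (∀ x → (x ∈ U S₂) ⇔ (∃[ u ] ∃[ l ] (u ∈ U S₁ × l ∈ L S₂ × x ≡ u +ₙ l)))

  ProjEquiv : Rel ASection _
  ProjEquiv = EqClosure _⟶_

  IsAComplement : Subset (suc n) → Subset (suc n) → Set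
  IsAComplement H H′ =
      IsAGroup H′
    × (∀ x → x ∈ H → x ∈ H′ → x ≡ zero)
    × (∀ x → ∃[ h ] ∃[ h′ ] (h ∈ H × h′ ∈ H′ × x ≡ h +ₙ h′))

  _≡[_]_ : Zn n → Subset (suc n) → Zn n → Set
  x ≡[ L ] y = (x -ₙ y) ∈ L

  -- For u ∈ U, the basic set of A_{U/L} containing ū is the image of the
  -- basic set of A containing u; v̄ lies in it iff this holds:
  InBasicOfSection : ASection → (u v : Zn n) → Set
  InBasicOfSection S u v = ∃[ w ] (w ∈ U S × lab w ≡ lab u × w ≡[ L S ] v)

  -- A_S = ℤS : every basic set of A_{U/L} is a singleton
  IsFullSection : ASection → Set
  IsFullSection S = ∀ u w → u ∈ U S → w ∈ U S → lab u ≡ lab w → u ≡[ L S ] w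

  -- A is Cayley isomorphic to A_{S₁} ⊗ A_{S₂}: there is a group
  -- isomorphism φ : G → (U₁/L₁) × (U₂/L₂), given by lifts f₁, f₂
  -- (fᵢ x ∈ Uᵢ a representative of the i-th coordinate of φ x), such that
  -- for every x, φ maps the basic set of A containing x onto the basic set
  -- X₁ × X₂ of A_{S₁} ⊗ A_{S₂} containing φ x.
  CayleyIsoTensor : ASection → ASection → Set
  CayleyIsoTensor S₁ S₂ =
    Σ (Zn n → Zn n) λ f₁ → Σ (Zn n → Zn n) λ f₂ →
        (∀ x → f₁ x ∈ U S₁) × (∀ x → f₂ x ∈ U S₂)
      × (∀ x y → f₁ (x +ₙ y) ≡[ L S₁ ] (f₁ x +ₙ f₁ y))
      × (∀ x y → f₂ (x +ₙ y) ≡[ L S₂ ] (f₂ x +ₙ f₂ y))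
      × (∀ x y → f₁ x ≡[ L S₁ ] f₁ y → f₂ x ≡[ L S₂ ] f₂ y → x ≡ y)
      × (∀ v₁ v₂ → v₁ ∈ U S₁ → v₂ ∈ U S₂ →
           ∃[ x ] (f₁ x ≡[ L S₁ ] v₁ × f₂ x ≡[ L S₂ ] v₂))
      × (∀ x v₁ v₂ → v₁ ∈ U S₁ → v₂ ∈ U S₂ →
           (∃[ y ] (lab y ≡ lab x × f₁ y ≡[ L S₁ ] v₁ × f₂ y ≡[ L S₂ ] v₂))
           ⇔ (InBasicOfSection S₁ (f₁ x) v₁ × InBasicOfSection S₂ (f₂ x) v₂))

-- Write G = H ⊕ H′ with projections π onto H and π′ onto H′.  In a cyclic group every subgroup
-- is invariant under every endomorphism, in particular under π and π′; with this one checks that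
-- the shape "U = L ⊕ H′ with L ≤ H" of a section U/L is invariant under projective equivalence.
-- So S has this shape, and A_S = ℤS forces every element h′ of H′ to be thin ({h′} is a basic
-- set).  Translating by thin elements shows that every basic set is X + h′ with X ⊆ H a basic set
-- and h′ ∈ H′.  Symmetrically T has the shape U = L ⊕ H with L ≤ H′, and
-- x ↦ (π′ x + L_S, π x + L_T) is the Cayley isomorphism.

module Submission where

open import Defs
open import Algebra.Bundles using (AbelianGroup)
open import Algebra.Structures using (IsAbelianGroup)
import Algebra.Properties.AbelianGroup as AbelianGroupProperties
import Algebra.Properties.CommutativeSemigroup as CommutativeSemigroupProperties
import Algebra.Properties.Monoid.Mult as MonoidMultProperties
import Algebra.Properties.Quasigroup as QuasigroupProperties
open import Data.Empty using (⊥-elim)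
open import Data.Fin using (zero; toℕ; fromℕ<)
open import Data.Fin.Properties using (toℕ-fromℕ<; toℕ-injective; toℕ<n)
open import Data.Fin.Subset using (Subset; _∈_; ⊤; ⁅_⁆)
open import Data.Fin.Subset.Properties using (∈⊤; x∈⁅y⁆⇔x≡y)
open import Data.List using (List; []; _∷_; length)
open import Data.List.Membership.Propositional using () renaming (_∈_ to _∈ˡ_)
open import Data.List.Membership.Propositional.Properties using (∈-filter⁺; ∈-filter⁻; ∈-tabulate⁺)
open import Data.List.Relation.Unary.Any using (here; there)
open import Data.Nat using (ℕ; suc; _+_; _*_; _∸_; _%_; _≟_)
open import Data.Nat.Properties using (+-comm; +-assoc; *-comm; m+[n∸m]≡n; <⇒≤)
open import Data.Nat.DivMod using (%-distribˡ-+; m%n%n≡m%n; m<n⇒m%n≡m; n%n≡0; m%n<n)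
open import Data.Product using (∃; ∃-syntax; _×_; _,_; proj₁; proj₂)
open import Function.Base using (id; _∘_)
open import Function.Bundles using (_⇔_; Equivalence; mk⇔)
open import Relation.Binary.Construct.Closure.ReflexiveTransitive using (ε; _◅_)
open import Relation.Binary.Construct.Closure.Symmetric using (fwd; bwd)
open import Relation.Binary.PropositionalEquality
open import Relation.Nullary.Decidable using (_×-dec_)
open ≡-Reasoning

module _ {n : ℕ} where

  private
    N : ℕ
    N = suc n

  %-absorbˡ : ∀ a b → (a % N + b) % N ≡ (a + b) % N
  %-absorbˡ a b = begin
    (a % N + b) % N           ≡⟨ %-distribˡ-+ (a % N) b N ⟩
    (a % N % N + b % N) % N   ≡⟨ cong (λ t → (t + b % N) % N) (m%n%n≡m%n a N) ⟩
    (a % N + b % N) % N       ≡⟨ %-distribˡ-+ a b N ⟨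
    (a + b) % N               ∎

  %-absorbʳ : ∀ a b → (a + b % N) % N ≡ (a + b) % N
  %-absorbʳ a b = begin
    (a + b % N) % N   ≡⟨ cong (_% N) (+-comm a (b % N)) ⟩
    (b % N + a) % N   ≡⟨ %-absorbˡ b a ⟩
    (b + a) % N       ≡⟨ cong (_% N) (+-comm b a) ⟩
    (a + b) % N       ∎

  toℕ-+ₙ : ∀ (i j : Zn n) → toℕ (i +ₙ j) ≡ (toℕ i + toℕ j) % N
  toℕ-+ₙ i j = toℕ-fromℕ< _

  toℕ-mod : ∀ (i : Zn n) → toℕ i % N ≡ toℕ i
  toℕ-mod i = m<n⇒m%n≡m (toℕ<n i)

  +ₙ-assoc : ∀ (i j k : Zn n) → (i +ₙ j) +ₙ k ≡ i +ₙ (j +ₙ k)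
  +ₙ-assoc i j k = toℕ-injective (begin
    toℕ ((i +ₙ j) +ₙ k)        ≡⟨ toℕ-+ₙ (i +ₙ j) k ⟩
    (toℕ (i +ₙ j) + c) % N     ≡⟨ cong (λ t → (t + c) % N) (toℕ-+ₙ i j) ⟩
    ((a + b) % N + c) % N      ≡⟨ %-absorbˡ (a + b) c ⟩
    (a + b + c) % N            ≡⟨ cong (_% N) (+-assoc a b c) ⟩
    (a + (b + c)) % N          ≡⟨ %-absorbʳ a (b + c) ⟨
    (a + (b + c) % N) % N      ≡⟨ cong (λ t → (a + t) % N) (toℕ-+ₙ j k) ⟨
    (a + toℕ (j +ₙ k)) % N     ≡⟨ toℕ-+ₙ i (j +ₙ k) ⟨
    toℕ (i +ₙ (j +ₙ k))        ∎)
    where a = toℕ i; b = toℕ j; c = toℕ k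

  +ₙ-comm : ∀ (i j : Zn n) → i +ₙ j ≡ j +ₙ i
  +ₙ-comm i j = toℕ-injective (begin
    toℕ (i +ₙ j)             ≡⟨ toℕ-+ₙ i j ⟩
    (toℕ i + toℕ j) % N      ≡⟨ cong (_% N) (+-comm (toℕ i) (toℕ j)) ⟩
    (toℕ j + toℕ i) % N      ≡⟨ toℕ-+ₙ j i ⟨
    toℕ (j +ₙ i)             ∎)

  +ₙ-identityˡ : ∀ (i : Zn n) → zero +ₙ i ≡ i
  +ₙ-identityˡ i = toℕ-injective (trans (toℕ-+ₙ zero i) (toℕ-mod i))

  +ₙ-identityʳ : ∀ (i : Zn n) → i +ₙ zero ≡ i
  +ₙ-identityʳ i = trans (+ₙ-comm i zero) (+ₙ-identityˡ i)

  +ₙ-inverseʳ : ∀ (i : Zn n) → i +ₙ (-ₙ i) ≡ zero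
  +ₙ-inverseʳ i = toℕ-injective (begin
    toℕ (i +ₙ (-ₙ i))          ≡⟨ toℕ-+ₙ i (-ₙ i) ⟩
    (a + toℕ (-ₙ i)) % N       ≡⟨ cong (λ t → (a + t) % N) (toℕ-fromℕ< _) ⟩
    (a + (N ∸ a) % N) % N      ≡⟨ %-absorbʳ a (N ∸ a) ⟩
    (a + (N ∸ a)) % N          ≡⟨ cong (_% N) (m+[n∸m]≡n (<⇒≤ (toℕ<n i))) ⟩
    N % N                      ≡⟨ n%n≡0 N ⟩
    0                          ∎)
    where a = toℕ i

  +ₙ-inverseˡ : ∀ (i : Zn n) → (-ₙ i) +ₙ i ≡ zero
  +ₙ-inverseˡ i = trans (+ₙ-comm (-ₙ i) i) (+ₙ-inverseʳ i)

  +ₙ-isAbelianGroup : IsAbelianGroup _≡_ _+ₙ_ zero (λ i → -ₙ i)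
  +ₙ-isAbelianGroup = record
    { isGroup = record
      { isMonoid = record
        { isSemigroup = record
          { isMagma = record { isEquivalence = isEquivalence ; ∙-cong = cong₂ _+ₙ_ }
          ; assoc   = +ₙ-assoc
          }
        ; identity = +ₙ-identityˡ , +ₙ-identityʳ
        }
      ; inverse = +ₙ-inverseˡ , +ₙ-inverseʳ
      ; ⁻¹-cong = cong (λ i → -ₙ i)
      }
    ; comm = +ₙ-comm
    }

+ₙ-abelianGroup : ℕ → AbelianGroup _ _
+ₙ-abelianGroup n = record { isAbelianGroup = +ₙ-isAbelianGroup {n} }

module _ {n : ℕ} where

  private
    N : ℕ
    N = suc n

  open AbelianGroup (+ₙ-abelianGroup n) using (monoid)
  open MonoidMultProperties monoid public using () renaming (_×_ to _·_)
  open MonoidMultProperties monoid using (×-assocˡ)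

  one : Zn n
  one = fromℕ< (m%n<n 1 N)

  toℕ-·-one : ∀ k → toℕ (k · one) ≡ k % N
  toℕ-·-one 0       = refl
  toℕ-·-one (suc k) = begin
    toℕ (one +ₙ k · one)             ≡⟨ toℕ-+ₙ one (k · one) ⟩
    (toℕ one + toℕ (k · one)) % N    ≡⟨ cong₂ (λ s t → (s + t) % N) (toℕ-fromℕ< (m%n<n 1 N)) (toℕ-·-one k) ⟩
    (1 % N + k % N) % N              ≡⟨ %-distribˡ-+ 1 k N ⟨
    suc k % N                        ∎

  toℕ-·-one≡id : ∀ (x : Zn n) → toℕ x · one ≡ x
  toℕ-·-one≡id x = toℕ-injective (trans (toℕ-·-one (toℕ x)) (toℕ-mod x))

  IsEndomorphism : (Zn n → Zn n) → Set
  IsEndomorphism e = ∀ x y → e (x +ₙ y) ≡ e x +ₙ e y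

  endomorphism-· : ∀ e → IsEndomorphism e → ∀ k x → e (k · x) ≡ k · e x
  endomorphism-· e homo 0       x = identityˡ-unique (e zero) (e zero) (begin
    e zero +ₙ e zero     ≡⟨ homo zero zero ⟨
    e (zero +ₙ zero)     ≡⟨ cong e (+ₙ-identityˡ zero) ⟩
    e zero               ∎)
    where open AbelianGroupProperties (+ₙ-abelianGroup n) using (identityˡ-unique)
  endomorphism-· e homo (suc k) x =
    trans (homo x (k · x)) (cong (e x +ₙ_) (endomorphism-· e homo k x))

  -- Cyclicity: x = (toℕ x)·1, so an endomorphism is multiplication by the image of 1.
  endomorphism≡· : ∀ e → IsEndomorphism e → ∀ x → e x ≡ toℕ (e one) · x
  endomorphism≡· e homo x = begin
    e x                              ≡⟨ cong e (toℕ-·-one≡id x) ⟨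
    e (a · one)                      ≡⟨ endomorphism-· e homo a one ⟩
    a · e one                        ≡⟨ cong (a ·_) (toℕ-·-one≡id (e one)) ⟨
    a · (c · one)                    ≡⟨ ×-assocˡ one a c ⟩
    (a * c) · one                    ≡⟨ cong (_· one) (*-comm a c) ⟩
    (c * a) · one                    ≡⟨ ×-assocˡ one c a ⟨
    c · (a · one)                    ≡⟨ cong (c ·_) (toℕ-·-one≡id x) ⟩
    c · x                            ∎
    where a = toℕ x; c = toℕ (e one)

∈-length≢0 : ∀ {X : Set} {a : X} {xs : List X} → a ∈ˡ xs → length xs ≢ 0
∈-length≢0 (here _)  ()
∈-length≢0 (there _) ()

length≢0-∃∈ : ∀ {X : Set} (xs : List X) → length xs ≢ 0 → ∃ (_∈ˡ xs)
length≢0-∃∈ []      ≢0 = ⊥-elim (≢0 refl)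
length≢0-∃∈ (a ∷ _) _  = a , here refl

module _ {n : ℕ} (A : SRing n) where

  open SRing A
  open AbelianGroupProperties (+ₙ-abelianGroup n)
    using (x∙y⁻¹≈ε⇒x≈y; ⁻¹-involutive; ⁻¹-anti-homo‿-; xyx⁻¹≈y; //-rightDividesʳ; quasigroup)
  open QuasigroupProperties quasigroup using (x≈z//y)
  open CommutativeSemigroupProperties (AbelianGroup.commutativeSemigroup (+ₙ-abelianGroup n))
    using (interchange)

  private
    N : ℕ
    N = suc n

  -ₙ-exchange : ∀ (a b c d : Zn n) → a +ₙ b ≡ c +ₙ d → a -ₙ c ≡ d -ₙ b
  -ₙ-exchange a b c d a+b≡c+d = begin
    a -ₙ c                     ≡⟨ cong (_-ₙ c) (//-rightDividesʳ b a) ⟨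
    ((a +ₙ b) -ₙ b) -ₙ c       ≡⟨ cong (λ t → (t -ₙ b) -ₙ c) a+b≡c+d ⟩
    ((c +ₙ d) -ₙ b) -ₙ c       ≡⟨ cong (_-ₙ c) (+ₙ-assoc c d (-ₙ b)) ⟩
    (c +ₙ (d -ₙ b)) -ₙ c       ≡⟨ xyx⁻¹≈y c (d -ₙ b) ⟩
    d -ₙ b                     ∎

  module Subgroup {X : Subset N} (X-subgroup : IsSubgroup A X) where

    ε∈ : zero ∈ X
    ε∈ = proj₁ X-subgroup

    +-closed : ∀ {x y} → x ∈ X → y ∈ X → (x +ₙ y) ∈ X
    +-closed = proj₁ (proj₂ X-subgroup) _ _

    ⁻¹-closed : ∀ {x} → x ∈ X → (-ₙ x) ∈ X
    ⁻¹-closed = proj₂ (proj₂ X-subgroup) _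

    −-closed : ∀ {x y} → x ∈ X → y ∈ X → (x -ₙ y) ∈ X
    −-closed x∈ y∈ = +-closed x∈ (⁻¹-closed y∈)

    ·-closed : ∀ k {x} → x ∈ X → (k · x) ∈ X
    ·-closed 0       _  = ε∈
    ·-closed (suc k) x∈ = +-closed x∈ (·-closed k x∈)

    endomorphism-closed : ∀ e → IsEndomorphism e → ∀ {x} → x ∈ X → e x ∈ X
    endomorphism-closed e homo {x} x∈ =
      subst (_∈ X) (sym (endomorphism≡· e homo x)) (·-closed (toℕ (e one)) x∈)

    ≡⇒−∈ : ∀ {x y} → x ≡ y → (x -ₙ y) ∈ X
    ≡⇒−∈ {x} refl = subst (_∈ X) (sym (+ₙ-inverseʳ x)) ε∈

  -- U S = L S ⊕ Q with L S ⊆ P, for a decomposition G = P ⊕ Q.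
  record Splits (P Q : Subset N) (S : ASection A) : Set where
    field
      Q⊆U   : ∀ {x} → x ∈ Q → x ∈ U S
      L⊆P   : ∀ {x} → x ∈ L S → x ∈ P
      U∩P⊆L : ∀ {x} → x ∈ U S → x ∈ P → x ∈ L S

  record IsDirectSum (P Q : Subset N) : Set where
    field
      P-subgroup : IsSubgroup A P
      Q-subgroup : IsSubgroup A Q
      disjoint   : ∀ {x} → x ∈ P → x ∈ Q → x ≡ zero
      spanning   : ∀ x → ∃[ p ] ∃[ q ] (p ∈ P × q ∈ Q × x ≡ p +ₙ q)

  IsDirectSum-swap : ∀ {P Q} → IsDirectSum P Q → IsDirectSum Q P
  IsDirectSum-swap D = record
    { P-subgroup = Q-subgroup
    ; Q-subgroup = P-subgroup
    ; disjoint   = λ x∈Q x∈P → disjoint x∈P x∈Q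
    ; spanning   = λ x → let p , q , p∈P , q∈Q , x≡p+q = spanning x
                         in q , p , q∈Q , p∈P , trans x≡p+q (+ₙ-comm p q)
    }
    where open IsDirectSum D

  IsThin : Zn n → Set
  IsThin g = ∀ x → lab x ≡ lab g → x ≡ g

  thin-⁻¹ : ∀ {g} → IsThin g → IsThin (-ₙ g)
  thin-⁻¹ {g} g-thin x x~-g = begin
    x             ≡⟨ ⁻¹-involutive x ⟨
    -ₙ (-ₙ x)     ≡⟨ cong -ₙ_ (g-thin (-ₙ x) -x~g) ⟩
    -ₙ g          ∎
    where
    -x~g : lab (-ₙ x) ≡ lab g
    -x~g = trans (inverseClosed x (-ₙ g) x~-g) (cong lab (⁻¹-involutive g))

  mult-witness⇒≢0 : ∀ {x y z} a → lab a ≡ lab x → lab (z -ₙ a) ≡ lab y → mult lab x y z ≢ 0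
  mult-witness⇒≢0 {x} {y} {z} a a∈X z-a∈Y =
    ∈-length≢0 (∈-filter⁺ (λ b → (lab b ≟ lab x) ×-dec (lab (z -ₙ b) ≟ lab y))
                          (∈-tabulate⁺ {f = λ i → i} a) (a∈X , z-a∈Y))

  mult≢0⇒witness : ∀ x y z → mult lab x y z ≢ 0 → ∃[ a ] (lab a ≡ lab x × lab (z -ₙ a) ≡ lab y)
  mult≢0⇒witness x y z ≢0 =
    let a , a∈ = length≢0-∃∈ _ ≢0
    in a , proj₂ (∈-filter⁻ (λ b → (lab b ≟ lab x) ×-dec (lab (z -ₙ b) ≟ lab y))
                            {xs = allElems} a∈)

  -- With Y the basic set of g + x, the coefficient of x in {-g}·Y is nonzero; by multClosed so is
  -- that of y, and as {-g} is a basic set this puts g + y in Y.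
  thin-translate : ∀ {g} → IsThin g → ∀ x y → lab x ≡ lab y → lab (g +ₙ x) ≡ lab (g +ₙ y)
  thin-translate {g} g-thin x y x~y =
    let a , a~-g , y-a~g+x = mult≢0⇒witness (-ₙ g) (g +ₙ x) y (λ mult≡0 →
          mult-witness⇒≢0 { -ₙ g} {g +ₙ x} {x} (-ₙ g) refl (cong lab (−-⁻¹≡+ x))
            (trans (multClosed (-ₙ g) (g +ₙ x) x y x~y) mult≡0))
    in begin
      lab (g +ₙ x)     ≡⟨ y-a~g+x ⟨
      lab (y -ₙ a)     ≡⟨ cong (λ t → lab (y -ₙ t)) (thin-⁻¹ g-thin a a~-g) ⟩
      lab (y -ₙ -ₙ g)  ≡⟨ cong lab (−-⁻¹≡+ y) ⟩
      lab (g +ₙ y)     ∎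
    where
    −-⁻¹≡+ : ∀ z → z -ₙ (-ₙ g) ≡ g +ₙ z
    −-⁻¹≡+ z = trans (cong (z +ₙ_) (⁻¹-involutive g)) (+ₙ-comm z g)

  module DirectSum {P Q : Subset N} (D : IsDirectSum P Q) where

    open IsDirectSum D
    private
      module P = Subgroup P-subgroup
      module Q = Subgroup Q-subgroup

    πP πQ : Zn n → Zn n
    πP x = proj₁ (spanning x)
    πQ x = proj₁ (proj₂ (spanning x))

    πP∈P : ∀ x → πP x ∈ P
    πP∈P x = proj₁ (proj₂ (proj₂ (spanning x)))

    πQ∈Q : ∀ x → πQ x ∈ Q
    πQ∈Q x = proj₁ (proj₂ (proj₂ (proj₂ (spanning x))))

    πP+πQ : ∀ x → x ≡ πP x +ₙ πQ x
    πP+πQ x = proj₂ (proj₂ (proj₂ (proj₂ (spanning x))))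

    πP≡x-πQ : ∀ x → πP x ≡ x -ₙ πQ x
    πP≡x-πQ x = x≈z//y (πP x) (πQ x) x (sym (πP+πQ x))

    π-unique : ∀ {x p q} → p ∈ P → q ∈ Q → x ≡ p +ₙ q → πP x ≡ p × πQ x ≡ q
    π-unique {x} {p} {q} p∈P q∈Q x≡p+q =
      x∙y⁻¹≈ε⇒x≈y _ _ πPx-p≡0 , sym (x∙y⁻¹≈ε⇒x≈y _ _ (trans (sym exchange) πPx-p≡0))
      where
      exchange : πP x -ₙ p ≡ q -ₙ πQ x
      exchange = -ₙ-exchange (πP x) (πQ x) p q (trans (sym (πP+πQ x)) x≡p+q)
      πPx-p≡0 : πP x -ₙ p ≡ zero
      πPx-p≡0 = disjoint (P.−-closed (πP∈P x) p∈P)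
                         (subst (_∈ Q) (sym exchange) (Q.−-closed q∈Q (πQ∈Q x)))

    π-injective : ∀ {x y} → πP x ≡ πP y → πQ x ≡ πQ y → x ≡ y
    π-injective {x} {y} πPx-πPy∈L πQx-πQy∈L =
      trans (πP+πQ x) (trans (cong₂ _+ₙ_ πPx-πPy∈L πQx-πQy∈L) (sym (πP+πQ y)))

    π-homo : ∀ x y → πP (x +ₙ y) ≡ πP x +ₙ πP y × πQ (x +ₙ y) ≡ πQ x +ₙ πQ y
    π-homo x y = π-unique (P.+-closed (πP∈P x) (πP∈P y)) (Q.+-closed (πQ∈Q x) (πQ∈Q y))
      (trans (cong₂ _+ₙ_ (πP+πQ x) (πP+πQ y)) (interchange (πP x) (πQ x) (πP y) (πQ y)))

    πP-endomorphism : IsEndomorphism πP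
    πP-endomorphism x y = proj₁ (π-homo x y)

    πQ-endomorphism : IsEndomorphism πQ
    πQ-endomorphism x y = proj₂ (π-homo x y)

    πQ-P : ∀ {x} → x ∈ P → πQ x ≡ zero
    πQ-P {x} x∈P = proj₂ (π-unique x∈P Q.ε∈ (sym (+ₙ-identityʳ x)))

    πQ-Q : ∀ {x} → x ∈ Q → πQ x ≡ x
    πQ-Q {x} x∈Q = proj₂ (π-unique P.ε∈ x∈Q (sym (+ₙ-identityˡ x)))

    πQ≡0⇒∈P : ∀ {x} → πQ x ≡ zero → x ∈ P
    πQ≡0⇒∈P {x} πQx≡0 = subst (_∈ P) πPx≡x (πP∈P x)
      where
      πPx≡x : πP x ≡ x
      πPx≡x = begin
        πP x             ≡⟨ +ₙ-identityʳ (πP x) ⟨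
        πP x +ₙ zero     ≡⟨ cong (πP x +ₙ_) πQx≡0 ⟨
        πP x +ₙ πQ x     ≡⟨ πP+πQ x ⟨
        x                ∎

    πP-closed : ∀ {X} → IsSubgroup A X → ∀ {x} → x ∈ X → πP x ∈ X
    πP-closed X-subgroup = Subgroup.endomorphism-closed X-subgroup πP πP-endomorphism

    πQ-closed : ∀ {X} → IsSubgroup A X → ∀ {x} → x ∈ X → πQ x ∈ X
    πQ-closed X-subgroup = Subgroup.endomorphism-closed X-subgroup πQ πQ-endomorphism

    module _ {S₁ S₂ : ASection A} (S₁⟶S₂ : _⟶_ A S₁ S₂) where

      open Equivalence
      private
        L₁⇔U₁∩L₂ : ∀ x → (x ∈ L S₁) ⇔ (x ∈ U S₁ × x ∈ L S₂)
        L₁⇔U₁∩L₂ = proj₁ S₁⟶S₂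

        U₂⇔U₁+L₂ : ∀ x → (x ∈ U S₂) ⇔ (∃[ u ] ∃[ l ] (u ∈ U S₁ × l ∈ L S₂ × x ≡ u +ₙ l))
        U₂⇔U₁+L₂ = proj₂ S₁⟶S₂

        L₂-subgroup : IsSubgroup A (L S₂)
        L₂-subgroup = proj₁ (L-AGroup S₂)

        U₁-subgroup : IsSubgroup A (U S₁)
        U₁-subgroup = proj₁ (U-AGroup S₁)

        U₁⊆U₂ : ∀ {x} → x ∈ U S₁ → x ∈ U S₂
        U₁⊆U₂ {x} x∈U₁ =
          from (U₂⇔U₁+L₂ x) (x , zero , x∈U₁ , Subgroup.ε∈ L₂-subgroup , sym (+ₙ-identityʳ x))

        L₁⊆L₂ : ∀ {x} → x ∈ L S₁ → x ∈ L S₂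
        L₁⊆L₂ {x} x∈L₁ = proj₂ (to (L₁⇔U₁∩L₂ x) x∈L₁)

      Splits-⟶ : Splits P Q S₁ → Splits P Q S₂
      Splits-⟶ S₁-splits = record { Q⊆U = U₁⊆U₂ ∘ Q⊆U ; L⊆P = L₂⊆P ; U∩P⊆L = U₂∩P⊆L₂ }
        where
        open Splits S₁-splits
        L₂⊆P : ∀ {x} → x ∈ L S₂ → x ∈ P
        L₂⊆P {l} l∈L₂ = πQ≡0⇒∈P (disjoint (L⊆P πQl∈L₁) (πQ∈Q l))
          where
          πQl∈L₁ : πQ l ∈ L S₁
          πQl∈L₁ = from (L₁⇔U₁∩L₂ (πQ l)) (Q⊆U (πQ∈Q l) , πQ-closed L₂-subgroup l∈L₂)
        U₂∩P⊆L₂ : ∀ {x} → x ∈ U S₂ → x ∈ P → x ∈ L S₂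
        U₂∩P⊆L₂ {x} x∈U₂ x∈P =
          let u , l , u∈U₁ , l∈L₂ , x≡u+l = to (U₂⇔U₁+L₂ x) x∈U₂
              u∈P = subst (_∈ P) (sym (x≈z//y u l x (sym x≡u+l))) (P.−-closed x∈P (L₂⊆P l∈L₂))
          in subst (_∈ L S₂) (sym x≡u+l)
               (Subgroup.+-closed L₂-subgroup (L₁⊆L₂ (U∩P⊆L u∈U₁ u∈P)) l∈L₂)

      Splits-⟵ : Splits P Q S₂ → Splits P Q S₁
      Splits-⟵ S₂-splits = record { Q⊆U = Q⊆U₁ ; L⊆P = L⊆P ∘ L₁⊆L₂ ; U∩P⊆L = U₁∩P⊆L₁ }
        where
        open Splits S₂-splits
        U₁∩P⊆L₁ : ∀ {x} → x ∈ U S₁ → x ∈ P → x ∈ L S₁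
        U₁∩P⊆L₁ {x} x∈U₁ x∈P = from (L₁⇔U₁∩L₂ x) (x∈U₁ , U∩P⊆L (U₁⊆U₂ x∈U₁) x∈P)
        -- x = u + l with u ∈ U₁, l ∈ L₂ ⊆ P, so x is the Q-component of u.
        Q⊆U₁ : ∀ {x} → x ∈ Q → x ∈ U S₁
        Q⊆U₁ {x} x∈Q =
          let u , l , u∈U₁ , l∈L₂ , x≡u+l = to (U₂⇔U₁+L₂ x) (Q⊆U x∈Q)
              u≡-l+x = trans (x≈z//y u l x (sym x≡u+l)) (+ₙ-comm x (-ₙ l))
          in subst (_∈ U S₁) (proj₂ (π-unique (P.⁻¹-closed (L⊆P l∈L₂)) x∈Q u≡-l+x))
               (πQ-closed U₁-subgroup u∈U₁)

    Splits-ProjEquiv : ∀ {S₁ S₂} → ProjEquiv A S₁ S₂ → Splits P Q S₂ → Splits P Q S₁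
    Splits-ProjEquiv ε                  = id
    Splits-ProjEquiv (fwd S₁⟶S ◅ S~S₂) = Splits-⟵ S₁⟶S ∘ Splits-ProjEquiv S~S₂
    Splits-ProjEquiv (bwd S⟶S₁ ◅ S~S₂) = Splits-⟶ S⟶S₁ ∘ Splits-ProjEquiv S~S₂

    G/P-splits : ∀ {S} → U S ≡ ⊤ → L S ≡ P → Splits P Q S
    G/P-splits U≡⊤ L≡P = record
      { Q⊆U   = λ {x} _ → subst (x ∈_) (sym U≡⊤) ∈⊤
      ; L⊆P   = λ {x} → subst (x ∈_) L≡P
      ; U∩P⊆L = λ {x} _ → subst (x ∈_) (sym L≡P)
      }

    Q/1-splits : ∀ {S} → U S ≡ Q → L S ≡ ⁅ zero ⁆ → Splits P Q S
    Q/1-splits {S} U≡Q L≡1 = record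
      { Q⊆U   = λ {x} → subst (x ∈_) (sym U≡Q)
      ; L⊆P   = λ {x} x∈L → subst (_∈ P) (sym (x≡0 x∈L)) P.ε∈
      ; U∩P⊆L = λ {x} x∈U x∈P → subst (x ∈_) (sym L≡1)
                  (Equivalence.from x∈⁅y⁆⇔x≡y (disjoint x∈P (subst (x ∈_) U≡Q x∈U)))
      }
      where
      x≡0 : ∀ {x} → x ∈ L S → x ≡ zero
      x≡0 {x} x∈L = Equivalence.to x∈⁅y⁆⇔x≡y (subst (x ∈_) L≡1 x∈L)

    module _ {S : ASection A} (S-splits : Splits P Q S) where

      open Splits S-splits

      Q-injective-mod-L : ∀ {a b} → a ∈ Q → b ∈ Q → (a -ₙ b) ∈ L S → a ≡ b
      Q-injective-mod-L a∈Q b∈Q a-b∈L = x∙y⁻¹≈ε⇒x≈y _ _ (disjoint (L⊆P a-b∈L) (Q.−-closed a∈Q b∈Q))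

      πQ-congruent-mod-L : ∀ {v} → v ∈ U S → (πQ v -ₙ v) ∈ L S
      πQ-congruent-mod-L {v} v∈U = subst (_∈ L S) (⁻¹-anti-homo‿- v (πQ v))
        (Subgroup.⁻¹-closed (proj₁ (L-AGroup S))
          (subst (_∈ L S) (πP≡x-πQ v) (U∩P⊆L (πP-closed (proj₁ (U-AGroup S)) v∈U) (πP∈P v))))

      full-section-thin : IsAGroup A Q → IsFullSection A S → ∀ {q} → q ∈ Q → IsThin q
      full-section-thin Q-AGroup S-full {q} q∈Q w w~q =
        sym (Q-injective-mod-L q∈Q w∈Q (S-full q w (Q⊆U q∈Q) (Q⊆U w∈Q) (sym w~q)))
        where
        w∈Q : w ∈ Q
        w∈Q = proj₂ Q-AGroup q w (sym w~q) q∈Q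

    -- Every basic set is a translate, by a thin element of Q, of a basic set inside P.
    module _ (P-AGroup : IsAGroup A P) (Q-thin : ∀ {q} → q ∈ Q → IsThin q) where

      private
        -πQ-thin : ∀ x → IsThin (-ₙ πQ x)
        -πQ-thin x = thin-⁻¹ (Q-thin (πQ∈Q x))

        -πQ+x≡πP : ∀ x → (-ₙ πQ x) +ₙ x ≡ πP x
        -πQ+x≡πP x = trans (+ₙ-comm (-ₙ πQ x) x) (sym (πP≡x-πQ x))

      πQ-basic : ∀ {x y} → lab x ≡ lab y → πQ x ≡ πQ y
      πQ-basic {x} {y} x~y = sym (x∙y⁻¹≈ε⇒x≈y (πQ y) (πQ x) (begin
        πQ y -ₙ πQ x           ≡⟨ +ₙ-comm (πQ y) g ⟩
        g +ₙ πQ y              ≡⟨ cong (_+ₙ πQ y) (πQ-Q (Q.⁻¹-closed (πQ∈Q x))) ⟨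
        πQ g +ₙ πQ y           ≡⟨ πQ-endomorphism g y ⟨
        πQ (g +ₙ y)            ≡⟨ πQ-P g+y∈P ⟩
        zero                   ∎))
        where
        g : Zn n
        g = -ₙ πQ x
        g+y∈P : (g +ₙ y) ∈ P
        g+y∈P = proj₂ P-AGroup (g +ₙ x) (g +ₙ y) (thin-translate (-πQ-thin x) x y x~y)
                  (subst (_∈ P) (sym (-πQ+x≡πP x)) (πP∈P x))

      πP-basic : ∀ {x y} → lab x ≡ lab y → lab (πP x) ≡ lab (πP y)
      πP-basic {x} {y} x~y = begin
        lab (πP x)               ≡⟨ cong lab (-πQ+x≡πP x) ⟨
        lab ((-ₙ πQ x) +ₙ x)     ≡⟨ thin-translate (-πQ-thin x) x y x~y ⟩
        lab ((-ₙ πQ x) +ₙ y)     ≡⟨ cong (λ t → lab ((-ₙ t) +ₙ y)) (πQ-basic x~y) ⟩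
        lab ((-ₙ πQ y) +ₙ y)     ≡⟨ cong lab (-πQ+x≡πP y) ⟩
        lab (πP y)               ∎

      +πQ-basic : ∀ {w x} → lab w ≡ lab (πP x) → lab (w +ₙ πQ x) ≡ lab x
      +πQ-basic {w} {x} w~πPx = begin
        lab (w +ₙ πQ x)          ≡⟨ cong lab (+ₙ-comm w (πQ x)) ⟩
        lab (πQ x +ₙ w)          ≡⟨ thin-translate (Q-thin (πQ∈Q x)) w (πP x) w~πPx ⟩
        lab (πQ x +ₙ πP x)       ≡⟨ cong lab (trans (+ₙ-comm (πQ x) (πP x)) (sym (πP+πQ x))) ⟩
        lab x                    ∎

  module _ {P Q : Subset N} (D : IsDirectSum P Q)
           (P-AGroup : IsAGroup A P) (Q-thin : ∀ {q} → q ∈ Q → IsThin q)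
           {S T : ASection A} (S-splits : Splits P Q S) (T-splits : Splits Q P T) where

    open DirectSum D
    private
      module S = Splits S-splits
      module T = Splits T-splits
      module D′ = DirectSum (IsDirectSum-swap D)

    π-injective-mod-L : ∀ x y → (πQ x -ₙ πQ y) ∈ L S → (πP x -ₙ πP y) ∈ L T → x ≡ y
    π-injective-mod-L x y πQx-πQy∈L πPx-πPy∈L = π-injective
      (D′.Q-injective-mod-L T-splits (πP∈P x) (πP∈P y) πPx-πPy∈L)
      (Q-injective-mod-L S-splits (πQ∈Q x) (πQ∈Q y) πQx-πQy∈L)

    -- The preimage of (v₁ + L S, v₂ + L T) is πP v₂ + πQ v₁.
    π-surjective-mod-L : ∀ v₁ v₂ → v₁ ∈ U S → v₂ ∈ U T →
                         ∃[ x ] ((πQ x -ₙ v₁) ∈ L S × (πP x -ₙ v₂) ∈ L T)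
    π-surjective-mod-L v₁ v₂ v₁∈U v₂∈U =
      let πPx≡πPv₂ , πQx≡πQv₁ = π-unique (πP∈P v₂) (πQ∈Q v₁) refl
      in πP v₂ +ₙ πQ v₁
       , subst (λ t → (t -ₙ v₁) ∈ L S) (sym πQx≡πQv₁) (πQ-congruent-mod-L S-splits v₁∈U)
       , subst (λ t → (t -ₙ v₂) ∈ L T) (sym πPx≡πPv₂) (D′.πQ-congruent-mod-L T-splits v₂∈U)

    π-basic : ∀ x v₁ v₂ →
      (∃[ y ] (lab y ≡ lab x × (πQ y -ₙ v₁) ∈ L S × (πP y -ₙ v₂) ∈ L T))
      ⇔ (InBasicOfSection A S (πQ x) v₁ × InBasicOfSection A T (πP x) v₂)
    π-basic x v₁ v₂ = mk⇔ to from
      where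
      to : ∃[ y ] (lab y ≡ lab x × (πQ y -ₙ v₁) ∈ L S × (πP y -ₙ v₂) ∈ L T)
         → InBasicOfSection A S (πQ x) v₁ × InBasicOfSection A T (πP x) v₂
      to (y , y~x , πQy-v₁∈L , πPy-v₂∈L) =
          (πQ y , S.Q⊆U (πQ∈Q y) , cong lab (πQ-basic P-AGroup Q-thin y~x) , πQy-v₁∈L)
        , (πP y , T.Q⊆U (πP∈P y) , πP-basic P-AGroup Q-thin y~x , πPy-v₂∈L)
      from : InBasicOfSection A S (πQ x) v₁ × InBasicOfSection A T (πP x) v₂
           → ∃[ y ] (lab y ≡ lab x × (πQ y -ₙ v₁) ∈ L S × (πP y -ₙ v₂) ∈ L T)
      from ((w₁ , _ , w₁~πQx , w₁-v₁∈L) , (w₂ , _ , w₂~πPx , w₂-v₂∈L)) =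
        let w₂∈P = proj₂ P-AGroup (πP x) w₂ (sym w₂~πPx) (πP∈P x)
            πPy≡w₂ , πQy≡πQx = π-unique w₂∈P (πQ∈Q x) refl
            w₁≡πQx = Q-thin (πQ∈Q x) w₁ w₁~πQx
        in w₂ +ₙ πQ x
         , +πQ-basic P-AGroup Q-thin w₂~πPx
         , subst (λ t → (t -ₙ v₁) ∈ L S) (trans w₁≡πQx (sym πQy≡πQx)) w₁-v₁∈L
         , subst (λ t → (t -ₙ v₂) ∈ L T) (sym πPy≡w₂) w₂-v₂∈L

    splitting-cayleyIsoTensor : CayleyIsoTensor A S T
    splitting-cayleyIsoTensor =
        πQ , πP , S.Q⊆U ∘ πQ∈Q , T.Q⊆U ∘ πP∈P
      , (λ x y → Subgroup.≡⇒−∈ (proj₁ (L-AGroup S)) (πQ-endomorphism x y))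
      , (λ x y → Subgroup.≡⇒−∈ (proj₁ (L-AGroup T)) (πP-endomorphism x y))
      , π-injective-mod-L , π-surjective-mod-L , (λ x v₁ v₂ _ _ → π-basic x v₁ v₂)

theorem7p1 : (n : ℕ) (A : SRing n) (H : Subset (suc n)) →
    IsAGroup A H →
    (∃[ H′ ] IsAComplement A H H′) →
    (S GH : ASection A) → ASection.U GH ≡ ⊤ → ASection.L GH ≡ H →
    ProjEquiv A S GH → IsFullSection A S →
    (T H1 : ASection A) → ASection.U H1 ≡ H → ASection.L H1 ≡ ⁅ zero ⁆ →
    ProjEquiv A T H1 →
    CayleyIsoTensor A S T
theorem7p1 n A H H-AGroup (H′ , H′-AGroup , H∩H′≡0 , H+H′≡G)
           S GH U≡⊤ L≡H S~G/H S-full T H1 U≡H L≡1 T~H/1 =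
  splitting-cayleyIsoTensor A G≡H⊕H′ H-AGroup H′-thin S-splits T-splits
  where
  G≡H⊕H′ : IsDirectSum A H H′
  G≡H⊕H′ = record
    { P-subgroup = proj₁ H-AGroup
    ; Q-subgroup = proj₁ H′-AGroup
    ; disjoint   = H∩H′≡0 _
    ; spanning   = H+H′≡G
    }
  module H⊕H′ = DirectSum A G≡H⊕H′
  module H′⊕H = DirectSum A (IsDirectSum-swap A G≡H⊕H′)
  S-splits : Splits A H H′ S
  S-splits = H⊕H′.Splits-ProjEquiv S~G/H (H⊕H′.G/P-splits U≡⊤ L≡H)
  T-splits : Splits A H′ H T
  T-splits = H′⊕H.Splits-ProjEquiv T~H/1 (H′⊕H.Q/1-splits U≡H L≡1)
  H′-thin : ∀ {q} → q ∈ H′ → IsThin A q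
  H′-thin = H⊕H′.full-section-thin S-splits H′-AGroup S-full
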